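{- Let $P_1$ and $P_2$ be finite posets and let $P$ be their disjoint union, with every element of $P_1$ incomparable to every element of $P_2$. If $\Lambda^*(P_1)$ and $\Lambda^*(P_2)$ are finite, then $\Lambda^*(P) \le \max\{\Lambda^*(P_1), \Lambda^*(P_2)\} + 8$.
   Context: For a positive integer $n$, $\mathcal{B}_n$ is the family of subsets of $[n]=\{1,\dots,n\}$ ordered by inclusion. A family $\mathcal{F}\subseteq\mathcal{B}_n$ contains a copy of a poset $Q$ if some subset of $\mathcal{F}$, with the order induced by inclusion, is isomorphic to $Q$; otherwise it is $Q$-free. $\ell(\mathcal{F})=\sum_{A\in\mathcal{F}}1/\binom{n}{|A|}$ and $\Lambda^*(Q)=\sup\{\ell(\mathcal{F}) : n\ge1,\ \mathcal{F}\subseteq\mathcal{B}_n\ Q\text{ -free}\}$. -}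

module Defs where

open import Data.Nat as ℕ using (ℕ; zero; suc)
open import Data.Nat.Combinatorics using (_C_)
open import Data.Integer using (+_)
open import Data.Rational using (ℚ; 0ℚ; _/_; _+_; _≤_; _⊔_)
open import Data.Bool using (Bool; true; false; if_then_else_)
open import Data.Fin using (Fin; splitAt; join)
open import Data.Fin.Properties using (join-splitAt)
open import Data.Fin.Subset using (Subset; _⊆_; ∣_∣)
open import Data.Vec using ([]; _∷_)
open import Data.List using (List; []; _∷_; map; _++_; foldr)
open import Data.Sum using (inj₁; inj₂)
open import Data.Sum.Relation.Binary.Pointwise using (Pointwise; inj₁; inj₂; Pointwise-≡⇒≡)
open import Data.Product using (Σ; _×_; _,_)
open import Function using (_⇔_)
open import Function.Definitions using (Injective)
open import Relation.Binary.Structures using (IsPartialOrder; IsPreorder)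
open import Relation.Binary.PropositionalEquality
  using (_≡_; refl; isEquivalence; subst; cong; trans; sym)

record FinPoset : Set₁ where
  field
    size           : ℕ
    _≼_            : Fin size → Fin size → Set
    isPartialOrder : IsPartialOrder _≡_ _≼_
  open IsPartialOrder isPartialOrder public

-- Disjoint union P₁ + P₂ on Fin (size P₁ + size P₂): the first
-- size P₁ elements are a copy of P₁, the rest a copy of P₂, and
-- elements of different parts are incomparable.
module _ (P₁ P₂ : FinPoset) where
  private
    module A = FinPoset P₁
    module B = FinPoset P₂
    k₁ = A.size
    k₂ = B.size

  ⊕-rel : Fin (k₁ ℕ.+ k₂) → Fin (k₁ ℕ.+ k₂) → Set
  ⊕-rel i j = Pointwise A._≼_ B._≼_ (splitAt k₁ i) (splitAt k₁ j)

  private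
    po-refl : ∀ {i j} → i ≡ j → ⊕-rel i j
    po-refl {i} refl with splitAt k₁ i
    ... | inj₁ a = inj₁ A.refl
    ... | inj₂ b = inj₂ B.refl

    ptrans : ∀ {x y z} → Pointwise A._≼_ B._≼_ x y → Pointwise A._≼_ B._≼_ y z →
             Pointwise A._≼_ B._≼_ x z
    ptrans (inj₁ p) (inj₁ q) = inj₁ (A.trans p q)
    ptrans (inj₂ p) (inj₂ q) = inj₂ (B.trans p q)

    pantisym : ∀ {x y} → Pointwise A._≼_ B._≼_ x y → Pointwise A._≼_ B._≼_ y x →
               Pointwise _≡_ _≡_ x y
    pantisym (inj₁ p) (inj₁ q) = inj₁ (A.antisym p q)
    pantisym (inj₂ p) (inj₂ q) = inj₂ (B.antisym p q)

    po-antisym : ∀ {i j} → ⊕-rel i j → ⊕-rel j i → i ≡ j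
    po-antisym {i} {j} p q =
      trans (sym (join-splitAt k₁ k₂ i))
        (trans (cong (join k₁ k₂) (Pointwise-≡⇒≡ (pantisym p q)))
               (join-splitAt k₁ k₂ j))

  _⊕_ : FinPoset
  _⊕_ = record
    { size = k₁ ℕ.+ k₂
    ; _≼_ = ⊕-rel
    ; isPartialOrder = record
      { isPreorder = record
        { isEquivalence = isEquivalence
        ; reflexive = po-refl
        ; trans = ptrans
        }
      ; antisym = po-antisym
      }
    }

-- The Boolean lattice B_n: subsets of [n] are `Subset n`; a family
-- F ⊆ B_n is given by its (Boolean) membership predicate.

Family : ℕ → Set
Family n = Subset n → Bool

allSubsets : (n : ℕ) → List (Subset n)
allSubsets zero    = [] ∷ []
allSubsets (suc n) = map (true ∷_) (allSubsets n) ++ map (false ∷_) (allSubsets n)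

-- 1 / binom(n, k)  (the binomial coefficient is never 0 when k ≤ n,
-- which is always the case below since k = |A| for A ⊆ [n]).
invBinom : ℕ → ℕ → ℚ
invBinom n k with n C k
... | zero  = 0ℚ
... | suc m = + 1 / suc m

lubell : (n : ℕ) → Family n → ℚ
lubell n F = foldr (λ A s → (if F A then invBinom n ∣ A ∣ else 0ℚ) + s) 0ℚ (allSubsets n)

ContainsCopy : (Q : FinPoset) → (n : ℕ) → Family n → Set
ContainsCopy Q n F =
  Σ (Fin (FinPoset.size Q) → Subset n) λ f →
    (∀ x → F (f x) ≡ true) ×
    Injective _≡_ _≡_ f ×
    (∀ x y → (FinPoset._≼_ Q x y ⇔ (f x ⊆ f y)))

Free : (Q : FinPoset) → (n : ℕ) → Family n → Set
Free Q n F = ContainsCopy Q n F → Data.Empty.⊥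
  where import Data.Empty

-- b is an upper bound for ℓ over all Q-free families (all n),
-- i.e. Λ*(Q) ≤ b.
LubellBound : FinPoset → ℚ → Set
LubellBound Q b = ∀ (n : ℕ) (F : Family n) → Free Q n F → lubell n F ≤ b

module Submission where

-- Write M = b₁ ⊔ b₂ and P = P₁ ⊕ P₂.  We show ℓ(F) ≤ M + 4 for every P-free
-- F ⊆ B_n by induction on n.  For n = m + 2 and an ordered pair of distinct
-- coordinates (x, y), let G_{x,y} be the family of B ⊆ [n] ∖ {x, y} with
-- B ∪ {x} ∈ F, and H_{x,y} that of B with B ∪ {y} ∈ F.  Every set of the first
-- kind is incomparable with every set of the second, so copies of P₁ in G and
-- of P₂ in H glue to a copy of P in F.  Hence either G is P₁-free or H is
-- P₂-free, while both are P-free; so ℓ(G) + ℓ(H) ≤ M + (M + 4) by induction.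
-- Double counting shows that the average of ℓ(G_{x,y}) and of ℓ(H_{x,y}) over
-- the n(n−1) pairs both equal the part μ(F) of ℓ(F) carried by the levels
-- 1, …, n−1 (this is the identity k(n−k)/C(n−2,k−1) = n(n−1)/C(n,k)); thus
-- 2μ(F) ≤ 2M + 4, and ℓ(F) ≤ 2 + μ(F) ≤ M + 4.

open import Defs
open import Data.Nat using (ℕ)
open import Data.Integer using (+_)
open import Data.Rational using (ℚ; _+_; _≤_; _⊔_; _/_)

open import Data.Nat as ℕ using (zero; suc; NonZero)
import Data.Nat.Properties as ℕP
open import Data.Nat.Combinatorics using (_C_; nCk+nC[k+1]≡[n+1]C[k+1]; nCk≡nC[n∸k])
open import Data.Nat.Solver using () renaming (module +-*-Solver to ℕ-Solver)
import Data.Integer as ℤ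
import Data.Integer.Properties as ℤP
open import Data.Integer.Solver using () renaming (module +-*-Solver to ℤ-Solver)
open import Data.Rational using (0ℚ; 1ℚ; _*_; toℚᵘ)
import Data.Rational.Properties as ℚP
open import Data.Rational.Solver using () renaming (module +-*-Solver to ℚ-Solver)
import Data.Rational.Unnormalised as ℚᵘ
import Data.Rational.Unnormalised.Properties as ℚᵘP
open import Algebra.Properties.CommutativeMonoid.Sum ℚP.+-0-commutativeMonoid
  using (sum-syntax; sum-cong-≗; ∑-distrib-+)
open import Data.Bool using (Bool; true; false; if_then_else_; not)
open import Data.Fin using (Fin; zero; suc; splitAt; join; punchIn)
open import Data.Fin.Properties using (join-splitAt)
open import Data.Fin.Subset using (Subset; _⊆_; ∣_∣)
open import Data.Fin.Subset.Properties using (drop-∷-⊆; s⊆s; ⊆-antisym; ⊆-reflexive)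
open import Data.Vec using ([]; _∷_; lookup; insertAt; here; there)
open import Data.Vec.Properties
  using ([]=⇒lookup; lookup⇒[]=; insertAt-lookup; insertAt-punchIn)
open import Data.List using (List; []; _∷_; map; _++_; foldr)
open import Data.Sum using (_⊎_; inj₁; inj₂)
open import Data.Sum.Relation.Binary.Pointwise using (Pointwise; inj₁; inj₂)
open import Data.Product using (Σ; _,_; proj₁)
open import Data.Empty using (⊥; ⊥-elim)
open import Relation.Nullary using (¬_; yes; no)
open import Function using (_⇔_; mk⇔; Equivalence)
open import Relation.Binary.PropositionalEquality

∑-mono : ∀ k {f g : Fin k → ℚ} → (∀ i → f i ≤ g i) → ∑[ i < k ] f i ≤ ∑[ i < k ] g i
∑-mono zero    f≤g = ℚP.≤-refl
∑-mono (suc k) f≤g = ℚP.+-mono-≤ (f≤g zero) (∑-mono k (λ i → f≤g (suc i)))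

∑ₛ : (n : ℕ) → (Subset n → ℚ) → ℚ
∑ₛ zero    g = g []
∑ₛ (suc n) g = ∑ₛ n (λ A → g (true ∷ A)) + ∑ₛ n (λ A → g (false ∷ A))

∑ₛ-cong : ∀ n {f g : Subset n → ℚ} → (∀ A → f A ≡ g A) → ∑ₛ n f ≡ ∑ₛ n g
∑ₛ-cong zero    f≡g = f≡g []
∑ₛ-cong (suc n) f≡g =
  cong₂ _+_ (∑ₛ-cong n (λ A → f≡g (true ∷ A))) (∑ₛ-cong n (λ A → f≡g (false ∷ A)))

∑ₛ-mono : ∀ n {f g : Subset n → ℚ} → (∀ A → f A ≤ g A) → ∑ₛ n f ≤ ∑ₛ n g
∑ₛ-mono zero    f≤g = f≤g []
∑ₛ-mono (suc n) f≤g =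
  ℚP.+-mono-≤ (∑ₛ-mono n (λ A → f≤g (true ∷ A))) (∑ₛ-mono n (λ A → f≤g (false ∷ A)))

+-interchange : ∀ a b c d → (a + b) + (c + d) ≡ (a + c) + (b + d)
+-interchange = solve 4 (λ a b c d → (a :+ b) :+ (c :+ d) := (a :+ c) :+ (b :+ d)) refl
  where open ℚ-Solver

∑ₛ-distrib-+ : ∀ n (f g : Subset n → ℚ) → ∑ₛ n (λ A → f A + g A) ≡ ∑ₛ n f + ∑ₛ n g
∑ₛ-distrib-+ zero    f g = refl
∑ₛ-distrib-+ (suc n) f g =
  trans (cong₂ _+_ (∑ₛ-distrib-+ n f₁ g₁) (∑ₛ-distrib-+ n f₀ g₀))
        (+-interchange (∑ₛ n f₁) (∑ₛ n g₁) (∑ₛ n f₀) (∑ₛ n g₀))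
  where
  f₁ g₁ f₀ g₀ : Subset n → ℚ
  f₁ A = f (true ∷ A)
  g₁ A = g (true ∷ A)
  f₀ A = f (false ∷ A)
  g₀ A = g (false ∷ A)

∑ₛ-zero : ∀ n → ∑ₛ n (λ _ → 0ℚ) ≡ 0ℚ
∑ₛ-zero zero    = refl
∑ₛ-zero (suc n) = cong₂ _+_ (∑ₛ-zero n) (∑ₛ-zero n)

∑ₛ-*ˡ : ∀ n c (f : Subset n → ℚ) → ∑ₛ n (λ A → c * f A) ≡ c * ∑ₛ n f
∑ₛ-*ˡ zero    c f = refl
∑ₛ-*ˡ (suc n) c f = trans (cong₂ _+_ (∑ₛ-*ˡ n c _) (∑ₛ-*ˡ n c _)) (sym (ℚP.*-distribˡ-+ c _ _))

∑-∑ₛ-comm : ∀ k n (g : Fin k → Subset n → ℚ) →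
            ∑[ i < k ] ∑ₛ n (g i) ≡ ∑ₛ n (λ A → ∑[ i < k ] g i A)
∑-∑ₛ-comm zero    n g = sym (∑ₛ-zero n)
∑-∑ₛ-comm (suc k) n g =
  trans (cong (λ s → ∑ₛ n (g zero) + s) (∑-∑ₛ-comm k n (λ i → g (suc i))))
        (sym (∑ₛ-distrib-+ n _ _))

when : Bool → ℚ → ℚ
when b v = if b then v else 0ℚ

lubell-∑ₛ : ∀ n F → lubell n F ≡ ∑ₛ n (λ A → when (F A) (invBinom n ∣ A ∣))
lubell-∑ₛ n F = sumList-allSubsets n _
  where
  sumList : ∀ {n} → (Subset n → ℚ) → List (Subset n) → ℚ
  sumList g = foldr (λ A s → g A + s) 0ℚ

  sumList-++ : ∀ {n} (g : Subset n → ℚ) xs ys → sumList g (xs ++ ys) ≡ sumList g xs + sumList g ys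
  sumList-++ g []       ys = sym (ℚP.+-identityˡ _)
  sumList-++ g (x ∷ xs) ys =
    trans (cong (λ s → g x + s) (sumList-++ g xs ys)) (sym (ℚP.+-assoc (g x) _ _))

  sumList-map : ∀ {m n} (g : Subset n → ℚ) (h : Subset m → Subset n) xs →
                sumList g (map h xs) ≡ sumList (λ A → g (h A)) xs
  sumList-map g h []       = refl
  sumList-map g h (x ∷ xs) = cong (λ s → g (h x) + s) (sumList-map g h xs)

  sumList-allSubsets : ∀ n (g : Subset n → ℚ) → sumList g (allSubsets n) ≡ ∑ₛ n g
  sumList-allSubsets zero    g = ℚP.+-identityʳ _
  sumList-allSubsets (suc n) g =
    trans (sumList-++ g (map (true ∷_) (allSubsets n)) (map (false ∷_) (allSubsets n)))
      (cong₂ _+_ (trans (sumList-map g _ (allSubsets n)) (sumList-allSubsets n _))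
                 (trans (sumList-map g _ (allSubsets n)) (sumList-allSubsets n _)))

-- The natural number k as a rational; its arithmetic is transferred from the
-- unnormalised rationals, where it is integer arithmetic.
fromℕ : ℕ → ℚ
fromℕ k = + k / 1

unitFrac : ℕ → ℚ
unitFrac c = + 1 / suc c

fromℕ-toℚᵘ : ∀ a → toℚᵘ (fromℕ a) ℚᵘ.≃ ℚᵘ.mkℚᵘ (+ a) 0
fromℕ-toℚᵘ a = ℚP.toℚᵘ-fromℚᵘ (ℚᵘ.mkℚᵘ (+ a) 0)

unitFrac-toℚᵘ : ∀ c → toℚᵘ (unitFrac c) ℚᵘ.≃ ℚᵘ.mkℚᵘ (+ 1) c
unitFrac-toℚᵘ c = ℚP.toℚᵘ-fromℚᵘ (ℚᵘ.mkℚᵘ (+ 1) c)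

fromℕ-+ : ∀ a b → fromℕ (a ℕ.+ b) ≡ fromℕ a + fromℕ b
fromℕ-+ a b = ℚP.toℚᵘ-injective (ℚᵘP.≃-trans (fromℕ-toℚᵘ (a ℕ.+ b)) (ℚᵘP.≃-trans sumᵘ
  (ℚᵘP.≃-sym (ℚᵘP.≃-trans (ℚP.toℚᵘ-homo-+ (fromℕ a) (fromℕ b))
                          (ℚᵘP.+-cong (fromℕ-toℚᵘ a) (fromℕ-toℚᵘ b))))))
  where
  open ℤ-Solver
  sumᵘ : ℚᵘ.mkℚᵘ (+ (a ℕ.+ b)) 0 ℚᵘ.≃ (ℚᵘ.mkℚᵘ (+ a) 0 ℚᵘ.+ ℚᵘ.mkℚᵘ (+ b) 0)
  sumᵘ = ℚᵘ.*≡* (trans (cong (ℤ._* + 1) (ℤP.pos-+ a b))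
    (solve 2 (λ x y → (x :+ y) :* con (+ 1) := (x :* con (+ 1) :+ y :* con (+ 1)) :* con (+ 1))
           refl (+ a) (+ b)))

fromℕ-* : ∀ a b → fromℕ (a ℕ.* b) ≡ fromℕ a * fromℕ b
fromℕ-* a b = ℚP.toℚᵘ-injective (ℚᵘP.≃-trans (fromℕ-toℚᵘ (a ℕ.* b)) (ℚᵘP.≃-trans productᵘ
  (ℚᵘP.≃-sym (ℚᵘP.≃-trans (ℚP.toℚᵘ-homo-* (fromℕ a) (fromℕ b))
                          (ℚᵘP.*-cong (fromℕ-toℚᵘ a) (fromℕ-toℚᵘ b))))))
  where
  productᵘ : ℚᵘ.mkℚᵘ (+ (a ℕ.* b)) 0 ℚᵘ.≃ (ℚᵘ.mkℚᵘ (+ a) 0 ℚᵘ.* ℚᵘ.mkℚᵘ (+ b) 0)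
  productᵘ = ℚᵘ.*≡* (cong (ℤ._* + 1) (ℤP.pos-* a b))

+-fromℕ-* : ∀ k c → c + fromℕ k * c ≡ fromℕ (suc k) * c
+-fromℕ-* k c = begin
  c + fromℕ k * c            ≡⟨ cong (_+ fromℕ k * c) (sym (ℚP.*-identityˡ c)) ⟩
  1ℚ * c + fromℕ k * c       ≡⟨ sym (ℚP.*-distribʳ-+ c 1ℚ (fromℕ k)) ⟩
  (1ℚ + fromℕ k) * c         ≡⟨ cong (_* c) (sym (fromℕ-+ 1 k)) ⟩
  fromℕ (suc k) * c          ∎
  where open ≡-Reasoning

∑-const : ∀ k c → ∑[ i < k ] c ≡ fromℕ k * c
∑-const zero    c = sym (ℚP.*-zeroˡ c)
∑-const (suc k) c = trans (cong (λ s → c + s) (∑-const k c)) (+-fromℕ-* k c)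

∑∑-const : ∀ k l c → ∑[ i < k ] ∑[ j < l ] c ≡ fromℕ (k ℕ.* l) * c
∑∑-const k l c = begin
  ∑[ i < k ] ∑[ j < l ] c      ≡⟨ sum-cong-≗ {k} (λ _ → ∑-const l c) ⟩
  ∑[ i < k ] (fromℕ l * c)     ≡⟨ ∑-const k (fromℕ l * c) ⟩
  fromℕ k * (fromℕ l * c)      ≡⟨ sym (ℚP.*-assoc (fromℕ k) (fromℕ l) c) ⟩
  fromℕ k * fromℕ l * c        ≡⟨ cong (_* c) (sym (fromℕ-* k l)) ⟩
  fromℕ (k ℕ.* l) * c          ∎
  where open ≡-Reasoning

unitFrac-inverse : ∀ c → unitFrac c * fromℕ (suc c) ≡ 1ℚ
unitFrac-inverse c = ℚP.toℚᵘ-injective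
  (ℚᵘP.≃-trans (ℚP.toℚᵘ-homo-* (unitFrac c) (fromℕ (suc c)))
  (ℚᵘP.≃-trans (ℚᵘP.*-cong (unitFrac-toℚᵘ c) (fromℕ-toℚᵘ (suc c))) productᵘ))
  where
  open ℤ-Solver
  productᵘ : (ℚᵘ.mkℚᵘ (+ 1) c ℚᵘ.* ℚᵘ.mkℚᵘ (+ suc c) 0) ℚᵘ.≃ ℚᵘ.mkℚᵘ (+ 1) 0
  productᵘ = ℚᵘ.*≡* (solve 1 (λ x → (con (+ 1) :* x) :* con (+ 1) := con (+ 1) :* (x :* con (+ 1)))
                          refl (+ suc c))

unitFrac≤1 : ∀ c → unitFrac c ≤ 1ℚ
unitFrac≤1 c = ℚP.toℚᵘ-cancel-≤ (ℚᵘP.≤-respˡ-≃ (ℚᵘP.≃-sym (unitFrac-toℚᵘ c))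
  (ℚᵘ.*≤* (ℤP.≤-trans (ℤP.≤-reflexive (ℤP.*-identityˡ _)) (ℤ.+≤+ (ℕ.s≤s ℕ.z≤n)))))

cross-multiply : ∀ a b x y N → a ℕ.* b ℕ.* suc y ≡ N ℕ.* suc x →
                 fromℕ a * (fromℕ b * unitFrac x) ≡ fromℕ N * unitFrac y
cross-multiply a b x y N eq = begin
  fromℕ a * (fromℕ b * unitFrac x)
    ≡⟨ sym (ℚP.*-identityʳ _) ⟩
  fromℕ a * (fromℕ b * unitFrac x) * 1ℚ
    ≡⟨ cong (fromℕ a * (fromℕ b * unitFrac x) *_) (sym (unitFrac-inverse y)) ⟩
  fromℕ a * (fromℕ b * unitFrac x) * (unitFrac y * fromℕ (suc y))
    ≡⟨ solve 5 (λ p q u v w → p :* (q :* u) :* (v :* w) := p :* q :* w :* (u :* v))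
               refl (fromℕ a) (fromℕ b) (unitFrac x) (unitFrac y) (fromℕ (suc y)) ⟩
  fromℕ a * fromℕ b * fromℕ (suc y) * (unitFrac x * unitFrac y)
    ≡⟨ cong (_* (unitFrac x * unitFrac y)) (sym lhs-as-ℕ) ⟩
  fromℕ (a ℕ.* b ℕ.* suc y) * (unitFrac x * unitFrac y)
    ≡⟨ cong (λ k → fromℕ k * (unitFrac x * unitFrac y)) eq ⟩
  fromℕ (N ℕ.* suc x) * (unitFrac x * unitFrac y)
    ≡⟨ cong (_* (unitFrac x * unitFrac y)) (fromℕ-* N (suc x)) ⟩
  fromℕ N * fromℕ (suc x) * (unitFrac x * unitFrac y)
    ≡⟨ solve 4 (λ p q u v → p :* q :* (u :* v) := p :* v :* (u :* q))
               refl (fromℕ N) (fromℕ (suc x)) (unitFrac x) (unitFrac y) ⟩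
  fromℕ N * unitFrac y * (unitFrac x * fromℕ (suc x))
    ≡⟨ cong (fromℕ N * unitFrac y *_) (unitFrac-inverse x) ⟩
  fromℕ N * unitFrac y * 1ℚ
    ≡⟨ ℚP.*-identityʳ _ ⟩
  fromℕ N * unitFrac y ∎
  where
  open ≡-Reasoning
  open ℚ-Solver
  lhs-as-ℕ : fromℕ (a ℕ.* b ℕ.* suc y) ≡ fromℕ a * fromℕ b * fromℕ (suc y)
  lhs-as-ℕ = trans (fromℕ-* (a ℕ.* b) (suc y)) (cong (_* fromℕ (suc y)) (fromℕ-* a b))

pascal : ∀ n k → suc n C suc k ≡ n C k ℕ.+ n C suc k
pascal n k = sym (nCk+nC[k+1]≡[n+1]C[k+1] n k)

binom-pos : ∀ n k → k ℕ.≤ n → Σ ℕ λ c → n C k ≡ suc c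
binom-pos n       zero    _             = 0 , refl
binom-pos (suc n) (suc k) (ℕ.s≤s k≤n) with binom-pos n k k≤n
... | c , eq = c ℕ.+ n C suc k , trans (pascal n k) (cong (ℕ._+ n C suc k) eq)

invBinom-unitFrac : ∀ n k c → n C k ≡ suc c → invBinom n k ≡ unitFrac c
invBinom-unitFrac n k c eq with n C k | eq
... | .(suc c) | refl = refl

invBinom≤1 : ∀ n k → invBinom n k ≤ 1ℚ
invBinom≤1 n k with n C k
... | zero  = ℚP.≤ᵇ⇒≤ _
... | suc c = unitFrac≤1 c

absorption : ∀ n k → suc k ℕ.* (suc n C suc k) ≡ suc n ℕ.* (n C k)
absorption zero    zero    = refl
absorption zero    (suc k) = ℕP.*-zeroʳ (suc (suc k))
absorption (suc n) k = begin
  suc k ℕ.* (suc (suc n) C suc k)                    ≡⟨ cong (suc k ℕ.*_) (pascal (suc n) k) ⟩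
  suc k ℕ.* (X ℕ.+ suc n C suc k)                    ≡⟨ ℕP.*-distribˡ-+ (suc k) X _ ⟩
  suc k ℕ.* X ℕ.+ suc k ℕ.* (suc n C suc k)          ≡⟨ cong (suc k ℕ.* X ℕ.+_) (absorption n k) ⟩
  suc k ℕ.* X ℕ.+ suc n ℕ.* (n C k)                  ≡⟨ ℕP.+-assoc X (k ℕ.* X) _ ⟩
  X ℕ.+ (k ℕ.* X ℕ.+ suc n ℕ.* (n C k))              ≡⟨ cong (X ℕ.+_) (shifted k) ⟩
  suc (suc n) ℕ.* X                                  ∎
  where
  open ≡-Reasoning
  X : ℕ
  X = suc n C k
  shifted : ∀ k → k ℕ.* (suc n C k) ℕ.+ suc n ℕ.* (n C k) ≡ suc n ℕ.* (suc n C k)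
  shifted zero     = refl
  shifted (suc k′) = begin
    suc k′ ℕ.* (suc n C suc k′) ℕ.+ suc n ℕ.* (n C suc k′)
      ≡⟨ cong (ℕ._+ suc n ℕ.* (n C suc k′)) (absorption n k′) ⟩
    suc n ℕ.* (n C k′) ℕ.+ suc n ℕ.* (n C suc k′)
      ≡⟨ sym (ℕP.*-distribˡ-+ (suc n) (n C k′) (n C suc k′)) ⟩
    suc n ℕ.* (n C k′ ℕ.+ n C suc k′)
      ≡⟨ cong (suc n ℕ.*_) (sym (pascal n k′)) ⟩
    suc n ℕ.* (suc n C suc k′) ∎

-- For j + d = m:  (j+1)(d+1) · C(m+2, j+1) = (m+2)(m+1) · C(m, j),
-- i.e. k(n−k) C(n, k) = n(n−1) C(n−2, k−1) with n = m + 2, k = j + 1.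
middle-binom : ∀ j d → suc j ℕ.* suc d ℕ.* (suc (suc (j ℕ.+ d)) C suc j)
                     ≡ suc (suc (j ℕ.+ d)) ℕ.* suc (j ℕ.+ d) ℕ.* ((j ℕ.+ d) C j)
middle-binom j d = begin
  suc j ℕ.* suc d ℕ.* Cn
    ≡⟨ solve 3 (λ a b c → a :* b :* c := b :* (a :* c)) refl (suc j) (suc d) Cn ⟩
  suc d ℕ.* (suc j ℕ.* Cn)
    ≡⟨ cong (suc d ℕ.*_) (absorption (suc m) j) ⟩
  suc d ℕ.* (suc (suc m) ℕ.* (suc m C j))
    ≡⟨ solve 3 (λ a b c → a :* (b :* c) := b :* (a :* c)) refl (suc d) (suc (suc m)) (suc m C j) ⟩
  suc (suc m) ℕ.* (suc d ℕ.* (suc m C j))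
    ≡⟨ cong (λ z → suc (suc m) ℕ.* (suc d ℕ.* z)) symmetry₁ ⟩
  suc (suc m) ℕ.* (suc d ℕ.* (suc m C suc d))
    ≡⟨ cong (suc (suc m) ℕ.*_) (absorption m d) ⟩
  suc (suc m) ℕ.* (suc m ℕ.* (m C d))
    ≡⟨ cong (λ z → suc (suc m) ℕ.* (suc m ℕ.* z)) symmetry₂ ⟩
  suc (suc m) ℕ.* (suc m ℕ.* (m C j))
    ≡⟨ sym (ℕP.*-assoc (suc (suc m)) (suc m) _) ⟩
  suc (suc m) ℕ.* suc m ℕ.* (m C j) ∎
  where
  open ≡-Reasoning
  open ℕ-Solver
  m : ℕ
  m = j ℕ.+ d
  Cn : ℕ
  Cn = suc (suc m) C suc j
  symmetry₁ : suc m C j ≡ suc m C suc d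
  symmetry₁ = trans (nCk≡nC[n∸k] (ℕP.≤-trans (ℕP.m≤m+n j d) (ℕP.n≤1+n m)))
                    (cong (suc m C_) (trans (cong (ℕ._∸ j) (sym (ℕP.+-suc j d))) (ℕP.m+n∸m≡n j (suc d))))
  symmetry₂ : m C d ≡ m C j
  symmetry₂ = trans (nCk≡nC[n∸k] (ℕP.m≤n+m d j)) (cong (m C_) (ℕP.m+n∸n≡m j d))

_≐_ : Bool → Bool → Bool
true  ≐ a = a
false ≐ a = not a

count : ∀ {n} → Bool → Subset n → ℕ
count b []      = 0
count b (a ∷ A) = if b ≐ a then suc (count b A) else count b A

∣∣≡count : ∀ {n} (A : Subset n) → ∣ A ∣ ≡ count true A
∣∣≡count []          = refl
∣∣≡count (true ∷ A)  = cong suc (∣∣≡count A)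
∣∣≡count (false ∷ A) = ∣∣≡count A

count-total : ∀ {n} (A : Subset n) → count true A ℕ.+ count false A ≡ n
count-total []          = refl
count-total (true ∷ A)  = cong suc (count-total A)
count-total (false ∷ A) = trans (ℕP.+-suc (count true A) _) (cong suc (count-total A))

count-insertAt : ∀ {n} b (A : Subset n) x c → count b (insertAt A x c) ≡ count b (c ∷ A)
count-insertAt b A       zero    c = refl
count-insertAt b (a ∷ A) (suc x) c with b ≐ a | b ≐ c | count-insertAt b A x c
... | true  | true  | ih = cong suc ih
... | true  | false | ih = cong suc ih
... | false | _     | ih = ih

count-insertAt-other : ∀ {n} b (A : Subset n) x → count (not b) (insertAt A x b) ≡ count (not b) A
count-insertAt-other true  A x = count-insertAt false A x true
count-insertAt-other false A x = count-insertAt true A x false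

∑-matching : ∀ {k} b (A : Subset k) v → ∑[ i < k ] when (b ≐ lookup A i) v ≡ fromℕ (count b A) * v
∑-matching b []      v = sym (ℚP.*-zeroˡ v)
∑-matching b (a ∷ A) v with b ≐ a
... | true  = trans (cong (λ s → v + s) (∑-matching b A v)) (+-fromℕ-* (count b A) v)
... | false = trans (ℚP.+-identityˡ _) (∑-matching b A v)

∑ₛ-insertAt : ∀ n x b (g : Subset (suc n) → ℚ) →
              ∑ₛ n (λ B → g (insertAt B x b)) ≡ ∑ₛ (suc n) (λ A → when (b ≐ lookup A x) (g A))
∑ₛ-insertAt n       zero    true  g =
  sym (trans (cong (λ s → ∑ₛ n (λ A → g (true ∷ A)) + s) (∑ₛ-zero n)) (ℚP.+-identityʳ _))
∑ₛ-insertAt n       zero    false g =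
  sym (trans (cong (_+ ∑ₛ n (λ A → g (false ∷ A))) (∑ₛ-zero n)) (ℚP.+-identityˡ _))
∑ₛ-insertAt (suc n) (suc x) b     g = cong₂ _+_ (∑ₛ-insertAt n x b (λ A → g (true ∷ A)))
                                                (∑ₛ-insertAt n x b (λ A → g (false ∷ A)))

∑-∑ₛ-insertAt : ∀ n b (g : Subset (suc n) → ℚ) →
                ∑[ x < suc n ] ∑ₛ n (λ B → g (insertAt B x b)) ≡ ∑ₛ (suc n) (λ A → fromℕ (count b A) * g A)
∑-∑ₛ-insertAt n b g = begin
  ∑[ x < suc n ] ∑ₛ n (λ B → g (insertAt B x b))
    ≡⟨ sum-cong-≗ (λ x → ∑ₛ-insertAt n x b g) ⟩
  ∑[ x < suc n ] ∑ₛ (suc n) (λ A → when (b ≐ lookup A x) (g A))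
    ≡⟨ ∑-∑ₛ-comm (suc n) (suc n) (λ x A → when (b ≐ lookup A x) (g A)) ⟩
  ∑ₛ (suc n) (λ A → ∑[ x < suc n ] when (b ≐ lookup A x) (g A))
    ≡⟨ ∑ₛ-cong (suc n) (λ A → ∑-matching b A (g A)) ⟩
  ∑ₛ (suc n) (λ A → fromℕ (count b A) * g A) ∎
  where open ≡-Reasoning

-- plant b x y B ⊆ [m+2]: the set B ⊆ [m] with coordinate b inserted at x and
-- coordinate (not b) inserted at the y-th of the remaining positions.  So
-- plant true x y B contains x but not the other new point, and plant false the
-- other way round.
plant : ∀ {m} → Bool → Fin (suc (suc m)) → Fin (suc m) → Subset m → Subset (suc (suc m))
plant b x y B = insertAt (insertAt B y (not b)) x b

planted : ∀ {m} → Family (suc (suc m)) → Bool → Fin (suc (suc m)) → Fin (suc m) → Family m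
planted F b x y B = F (plant b x y B)

count-plant : ∀ {m} b x y (B : Subset m) → count true (plant b x y B) ≡ suc (count true B)
count-plant true  x y B = trans (count-insertAt true _ x true) (cong suc (count-insertAt true B y false))
count-plant false x y B = trans (count-insertAt true _ x false) (count-insertAt true B y true)

∑-plant : ∀ m b (g : Subset (suc (suc m)) → ℚ) →
          ∑[ x < suc (suc m) ] ∑[ y < suc m ] ∑ₛ m (λ B → g (plant b x y B))
          ≡ ∑ₛ (suc (suc m)) (λ A → fromℕ (count b A) * (fromℕ (count (not b) A) * g A))
∑-plant m b g = begin
  ∑[ x < suc (suc m) ] ∑[ y < suc m ] ∑ₛ m (λ B → g (plant b x y B))
    ≡⟨ sum-cong-≗ (λ x → ∑-∑ₛ-insertAt m (not b) (λ A → g (insertAt A x b))) ⟩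
  ∑[ x < suc (suc m) ] ∑ₛ (suc m) (λ A → fromℕ (count (not b) A) * g (insertAt A x b))
    ≡⟨ sum-cong-≗ (λ x → ∑ₛ-cong (suc m) (λ A →
         cong (λ k → fromℕ k * g (insertAt A x b)) (sym (count-insertAt-other b A x)))) ⟩
  ∑[ x < suc (suc m) ] ∑ₛ (suc m) (λ A → weighted (insertAt A x b))
    ≡⟨ ∑-∑ₛ-insertAt (suc m) b weighted ⟩
  ∑ₛ (suc (suc m)) (λ A → fromℕ (count b A) * weighted A) ∎
  where
  open ≡-Reasoning
  weighted : Subset (suc (suc m)) → ℚ
  weighted A = fromℕ (count (not b) A) * g A

-- The Lubell weight of a set with k elements and f non-elements in [n],
-- restricted to sets strictly between ∅ and [n].
middleWeight : ℕ → ℕ → ℕ → ℚ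
middleWeight n zero    f       = 0ℚ
middleWeight n (suc k) zero    = 0ℚ
middleWeight n (suc k) (suc f) = invBinom n (suc k)

middleLubell : (n : ℕ) → Family n → ℚ
middleLubell n F = ∑ₛ n (λ A → when (F A) (middleWeight n (count true A) (count false A)))

middle-identity-interior : ∀ j d →
  fromℕ (suc j) * (fromℕ (suc d) * invBinom (j ℕ.+ d) j)
  ≡ fromℕ (suc (suc (j ℕ.+ d)) ℕ.* suc (j ℕ.+ d)) * invBinom (suc (suc (j ℕ.+ d))) (suc j)
middle-identity-interior j d
  with binom-pos (j ℕ.+ d) j (ℕP.m≤m+n j d)
     | binom-pos (suc (suc (j ℕ.+ d))) (suc j) (ℕ.s≤s (ℕP.≤-trans (ℕP.m≤m+n j d) (ℕP.n≤1+n _)))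
... | c , C≡ | c′ , C′≡ = begin
  fromℕ (suc j) * (fromℕ (suc d) * invBinom m j)
    ≡⟨ cong (λ z → fromℕ (suc j) * (fromℕ (suc d) * z)) (invBinom-unitFrac m j c C≡) ⟩
  fromℕ (suc j) * (fromℕ (suc d) * unitFrac c)
    ≡⟨ cross-multiply (suc j) (suc d) c c′ N cleared ⟩
  fromℕ N * unitFrac c′
    ≡⟨ cong (fromℕ N *_) (sym (invBinom-unitFrac n (suc j) c′ C′≡)) ⟩
  fromℕ N * invBinom n (suc j) ∎
  where
  open ≡-Reasoning
  m : ℕ
  m = j ℕ.+ d
  n : ℕ
  n = suc (suc m)
  N : ℕ
  N = n ℕ.* suc m
  cleared : suc j ℕ.* suc d ℕ.* suc c′ ≡ N ℕ.* suc c
  cleared = subst₂ (λ u v → suc j ℕ.* suc d ℕ.* u ≡ N ℕ.* v) C′≡ C≡ (middle-binom j d)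

middle-identity : ∀ m k f → k ℕ.+ f ≡ suc (suc m) →
  fromℕ k * (fromℕ f * invBinom m (ℕ.pred k)) ≡ fromℕ (suc (suc m) ℕ.* suc m) * middleWeight (suc (suc m)) k f
middle-identity m zero    f       _  =
  trans (ℚP.*-zeroˡ (fromℕ f * invBinom m 0)) (sym (ℚP.*-zeroʳ (fromℕ (suc (suc m) ℕ.* suc m))))
middle-identity m (suc j) zero    _  =
  trans (cong (fromℕ (suc j) *_) (ℚP.*-zeroˡ (invBinom m j)))
        (trans (ℚP.*-zeroʳ (fromℕ (suc j))) (sym (ℚP.*-zeroʳ (fromℕ (suc (suc m) ℕ.* suc m)))))
middle-identity m (suc j) (suc d) k+f≡n
  with ℕP.suc-injective (trans (sym (ℕP.+-suc j d)) (ℕP.suc-injective k+f≡n))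
... | refl = middle-identity-interior j d

when-scale : ∀ b c v → c * when b v ≡ when b (c * v)
when-scale true  c v = refl
when-scale false c v = ℚP.*-zeroʳ c

isZero : ℕ → ℚ
isZero zero    = 1ℚ
isZero (suc _) = 0ℚ

isZero-nonneg : ∀ k → 0ℚ ≤ isZero k
isZero-nonneg zero    = ℚP.≤ᵇ⇒≤ _
isZero-nonneg (suc k) = ℚP.≤-refl

∑ₛ-isZero-count : ∀ n b → ∑ₛ n (λ A → isZero (count b A)) ≡ 1ℚ
∑ₛ-isZero-count zero    b     = refl
∑ₛ-isZero-count (suc n) true  = trans (cong₂ _+_ (∑ₛ-zero n) (∑ₛ-isZero-count n true)) (ℚP.+-identityˡ _)
∑ₛ-isZero-count (suc n) false = trans (cong₂ _+_ (∑ₛ-isZero-count n false) (∑ₛ-zero n)) (ℚP.+-identityʳ _)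

≤-+-nonnegʳ : ∀ {x y z} → x ≤ y → 0ℚ ≤ z → x ≤ y + z
≤-+-nonnegʳ {x} {y} {z} x≤y 0≤z = subst (_≤ y + z) (ℚP.+-identityʳ x) (ℚP.+-mono-≤ x≤y 0≤z)

≤-+-nonnegˡ : ∀ {x y z} → x ≤ y → 0ℚ ≤ z → x ≤ z + y
≤-+-nonnegˡ {x} {y} {z} x≤y 0≤z = subst (_≤ z + y) (ℚP.+-identityˡ x) (ℚP.+-mono-≤ 0≤z x≤y)

weight≤extreme+middle : ∀ n b k f → when b (invBinom n k) ≤ (isZero k + isZero f) + when b (middleWeight n k f)
weight≤extreme+middle n false k       f       =
  ≤-+-nonnegʳ (ℚP.+-mono-≤ (isZero-nonneg k) (isZero-nonneg f)) ℚP.≤-refl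
weight≤extreme+middle n true  zero    f       =
  ≤-+-nonnegʳ (≤-+-nonnegʳ (invBinom≤1 n 0) (isZero-nonneg f)) ℚP.≤-refl
weight≤extreme+middle n true  (suc k) zero    =
  ≤-+-nonnegʳ (≤-+-nonnegˡ (invBinom≤1 n (suc k)) ℚP.≤-refl) ℚP.≤-refl
weight≤extreme+middle n true  (suc k) (suc f) = ≤-+-nonnegˡ ℚP.≤-refl ℚP.≤-refl

-- ℓ(F) ≤ 2 + μ(F): the levels 0 and n contribute at most 1 each.
lubell≤2+middle : ∀ n F → lubell n F ≤ fromℕ 2 + middleLubell n F
lubell≤2+middle n F = begin
  lubell n F
    ≡⟨ lubell-∑ₛ n F ⟩
  ∑ₛ n (λ A → when (F A) (invBinom n ∣ A ∣))
    ≡⟨ ∑ₛ-cong n (λ A → cong (λ k → when (F A) (invBinom n k)) (∣∣≡count A)) ⟩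
  ∑ₛ n (λ A → when (F A) (invBinom n (count true A)))
    ≤⟨ ∑ₛ-mono n (λ A → weight≤extreme+middle n (F A) (count true A) (count false A)) ⟩
  ∑ₛ n (λ A → (isZero (count true A) + isZero (count false A)) + mid A)
    ≡⟨ ∑ₛ-distrib-+ n _ mid ⟩
  ∑ₛ n (λ A → isZero (count true A) + isZero (count false A)) + middleLubell n F
    ≡⟨ cong (_+ middleLubell n F) (trans (∑ₛ-distrib-+ n _ _)
         (cong₂ _+_ (∑ₛ-isZero-count n true) (∑ₛ-isZero-count n false))) ⟩
  fromℕ 2 + middleLubell n F ∎
  where
  open ℚP.≤-Reasoning
  mid : Subset n → ℚ
  mid A = when (F A) (middleWeight n (count true A) (count false A))

∑-lubell-planted : ∀ m (F : Family (suc (suc m))) b →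
  ∑[ x < suc (suc m) ] ∑[ y < suc m ] lubell m (planted F b x y)
  ≡ fromℕ (suc (suc m) ℕ.* suc m) * middleLubell (suc (suc m)) F
∑-lubell-planted m F b = begin
  ∑[ x < n ] ∑[ y < suc m ] lubell m (planted F b x y)
    ≡⟨ sum-cong-≗ (λ x → sum-cong-≗ (λ y → lubell-planted x y)) ⟩
  ∑[ x < n ] ∑[ y < suc m ] ∑ₛ m (λ B → w (plant b x y B))
    ≡⟨ ∑-plant m b w ⟩
  ∑ₛ n (λ A → fromℕ (count b A) * (fromℕ (count (not b) A) * w A))
    ≡⟨ ∑ₛ-cong n (counted b) ⟩
  ∑ₛ n (λ A → fromℕ N * mid A)
    ≡⟨ ∑ₛ-*ˡ n (fromℕ N) mid ⟩
  fromℕ N * middleLubell n F ∎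
  where
  open ≡-Reasoning
  n : ℕ
  n = suc (suc m)
  N : ℕ
  N = n ℕ.* suc m

  -- the weight of A ∈ F seen from B ⊆ [m] with A = plant b x y B
  w : Subset n → ℚ
  w A = when (F A) (invBinom m (ℕ.pred (count true A)))

  mid : Subset n → ℚ
  mid A = when (F A) (middleWeight n (count true A) (count false A))

  lubell-planted : ∀ x y → lubell m (planted F b x y) ≡ ∑ₛ m (λ B → w (plant b x y B))
  lubell-planted x y = trans (lubell-∑ₛ m _) (∑ₛ-cong m (λ B →
    cong (λ k → when (F (plant b x y B)) (invBinom m k))
         (trans (∣∣≡count B) (cong ℕ.pred (sym (count-plant b x y B))))))

  counted-true : ∀ A → fromℕ (count true A) * (fromℕ (count false A) * w A) ≡ fromℕ N * mid A
  counted-true A = begin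
    fromℕ k * (fromℕ f * when (F A) v)    ≡⟨ cong (fromℕ k *_) (when-scale (F A) (fromℕ f) v) ⟩
    fromℕ k * when (F A) (fromℕ f * v)    ≡⟨ when-scale (F A) (fromℕ k) _ ⟩
    when (F A) (fromℕ k * (fromℕ f * v))  ≡⟨ cong (when (F A)) (middle-identity m k f (count-total A)) ⟩
    when (F A) (fromℕ N * middleWeight n k f)  ≡⟨ sym (when-scale (F A) (fromℕ N) _) ⟩
    fromℕ N * mid A ∎
    where
    k : ℕ
    k = count true A
    f : ℕ
    f = count false A
    v : ℚ
    v = invBinom m (ℕ.pred k)

  counted : ∀ b A → fromℕ (count b A) * (fromℕ (count (not b) A) * w A) ≡ fromℕ N * mid A
  counted true  A = counted-true A
  counted false A = trans (solve 3 (λ p q r → p :* (q :* r) := q :* (p :* r)) refl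
                                   (fromℕ (count false A)) (fromℕ (count true A)) (w A))
                          (counted-true A)
    where open ℚ-Solver

∑-lubell-planted-pairs : ∀ m (F : Family (suc (suc m))) →
  ∑[ x < suc (suc m) ] ∑[ y < suc m ] (lubell m (planted F true x y) + lubell m (planted F false x y))
  ≡ fromℕ (suc (suc m) ℕ.* suc m) * (middleLubell (suc (suc m)) F + middleLubell (suc (suc m)) F)
∑-lubell-planted-pairs m F =
  trans (sum-cong-≗ (λ x → ∑-distrib-+ (λ y → lubell m (planted F true x y))
                                       (λ y → lubell m (planted F false x y))))
  (trans (∑-distrib-+ (λ x → ∑[ y < suc m ] lubell m (planted F true x y))
                      (λ x → ∑[ y < suc m ] lubell m (planted F false x y)))
  (trans (cong₂ _+_ (∑-lubell-planted m F true) (∑-lubell-planted m F false))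
         (sym (ℚP.*-distribˡ-+ (fromℕ (suc (suc m) ℕ.* suc m)) _ _))))

record OrderEmbedding (m n : ℕ) : Set where
  field
    embed      : Subset m → Subset n
    monotone   : ∀ {A B} → A ⊆ B → embed A ⊆ embed B
    reflecting : ∀ {A B} → embed A ⊆ embed B → A ⊆ B

  injective : ∀ {A B} → embed A ≡ embed B → A ≡ B
  injective eq = ⊆-antisym (reflecting (⊆-reflexive eq)) (reflecting (⊆-reflexive (sym eq)))

open OrderEmbedding

insertAt-⊆ : ∀ {n} {A B : Subset n} x b → A ⊆ B → insertAt A x b ⊆ insertAt B x b
insertAt-⊆ zero b A⊆B = s⊆s A⊆B
insertAt-⊆ {A = a ∷ A} {c ∷ B} (suc x) b A⊆B here with A⊆B here
... | here = here
insertAt-⊆ {A = a ∷ A} {c ∷ B} (suc x) b A⊆B (there i∈) = there (insertAt-⊆ x b (drop-∷-⊆ A⊆B) i∈)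

insertAt-⊆⁻ : ∀ {n} {A B : Subset n} x b → insertAt A x b ⊆ insertAt B x b → A ⊆ B
insertAt-⊆⁻ zero b A⊆B = drop-∷-⊆ A⊆B
insertAt-⊆⁻ {A = a ∷ A} {c ∷ B} (suc x) b A⊆B here with A⊆B here
... | here = here
insertAt-⊆⁻ {A = a ∷ A} {c ∷ B} (suc x) b A⊆B (there i∈) = there (insertAt-⊆⁻ x b (drop-∷-⊆ A⊆B) i∈)

insertion : ∀ {n} → Fin (suc n) → Bool → OrderEmbedding n (suc n)
insertion x b = record
  { embed = λ A → insertAt A x b ; monotone = insertAt-⊆ x b ; reflecting = insertAt-⊆⁻ x b }

_∘ₑ_ : ∀ {k m n} → OrderEmbedding m n → OrderEmbedding k m → OrderEmbedding k n
E ∘ₑ E′ = record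
  { embed = λ A → embed E (embed E′ A)
  ; monotone = λ A⊆B → monotone E (monotone E′ A⊆B)
  ; reflecting = λ A⊆B → reflecting E′ (reflecting E A⊆B)
  }

planting : ∀ {m} → Bool → Fin (suc (suc m)) → Fin (suc m) → OrderEmbedding m (suc (suc m))
planting b x y = insertion x b ∘ₑ insertion y (not b)

-- mk⇔ with the inclusion U ⊆ V fixed, so that its implicit argument is not guessed.
mk⇔⊆ : ∀ {n} {X : Set} {U V : Subset n} → (X → U ⊆ V) → (U ⊆ V → X) → X ⇔ (U ⊆ V)
mk⇔⊆ {X = X} {U} {V} = mk⇔ {A = X} {B = U ⊆ V}

embed-⇔ : ∀ {m n} {X : Set} (E : OrderEmbedding m n) {A B : Subset m} →
          X ⇔ (A ⊆ B) → X ⇔ (embed E A ⊆ embed E B)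
embed-⇔ E {A} {B} X⇔ =
  mk⇔⊆ (λ x → monotone E {A} {B} (Equivalence.to X⇔ x)) (λ e → Equivalence.from X⇔ (reflecting E {A} {B} e))

push-copy : ∀ {m n} (Q : FinPoset) (E : OrderEmbedding m n) (F : Family n) →
            ContainsCopy Q m (λ A → F (embed E A)) → ContainsCopy Q n F
push-copy Q E F (f , f∈F , f-inj , f-iso) =
  (λ a → embed E (f a)) , f∈F , (λ eq → f-inj (injective E eq)) , (λ a a′ → embed-⇔ E (f-iso a a′))

restrict-free : ∀ {m n} (Q : FinPoset) (E : OrderEmbedding m n) (F : Family n) →
                Free Q n F → Free Q m (λ A → F (embed E A))
restrict-free Q E F free copy = free (push-copy Q E F copy)

⊈-by-coordinate : ∀ {n} {A B : Subset n} i → lookup A i ≡ true → lookup B i ≡ false → ¬ (A ⊆ B)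
⊈-by-coordinate {B = B} i A∋i B∌i A⊆B with trans (sym ([]=⇒lookup (A⊆B (lookup⇒[]= i _ A∋i)))) B∌i
... | ()

-- Sets planted in opposite orientations are incomparable: they differ at
-- coordinate x and at the coordinate punchIn x y.
plant-incomparable : ∀ {m} x y (B B′ : Subset m) → ¬ (plant true x y B ⊆ plant false x y B′)
plant-incomparable x y B B′ =
  ⊈-by-coordinate x (insertAt-lookup _ x true) (insertAt-lookup _ x false)

plant-incomparable′ : ∀ {m} x y (B B′ : Subset m) → ¬ (plant false x y B′ ⊆ plant true x y B)
plant-incomparable′ x y B B′ = ⊈-by-coordinate (punchIn x y)
  (trans (insertAt-punchIn _ x false y) (insertAt-lookup B′ y true))
  (trans (insertAt-punchIn _ x true y) (insertAt-lookup B y false))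

glue-copies : ∀ (P₁ P₂ : FinPoset) n (F : Family n)
  (c₁ : ContainsCopy P₁ n F) (c₂ : ContainsCopy P₂ n F) →
  (∀ a b → ¬ (proj₁ c₁ a ⊆ proj₁ c₂ b)) → (∀ a b → ¬ (proj₁ c₂ b ⊆ proj₁ c₁ a)) →
  ContainsCopy (P₁ ⊕ P₂) n F
glue-copies P₁ P₂ n F (f₁ , f₁∈F , f₁-inj , f₁-iso) (f₂ , f₂∈F , f₂-inj , f₂-iso) ⊈₁₂ ⊈₂₁ =
  (λ i → g (splitAt k₁ i)) , (λ i → g∈F (splitAt k₁ i)) ,
  (λ {i} {j} eq → trans (sym (join-splitAt k₁ k₂ i))
                    (trans (cong (join k₁ k₂) (g-inj (splitAt k₁ i) (splitAt k₁ j) eq))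
                           (join-splitAt k₁ k₂ j))) ,
  (λ i j → g-iso (splitAt k₁ i) (splitAt k₁ j))
  where
  k₁ k₂ : ℕ
  k₁ = FinPoset.size P₁
  k₂ = FinPoset.size P₂

  g : Fin k₁ ⊎ Fin k₂ → Subset n
  g (inj₁ a) = f₁ a
  g (inj₂ b) = f₂ b

  g∈F : ∀ u → F (g u) ≡ true
  g∈F (inj₁ a) = f₁∈F a
  g∈F (inj₂ b) = f₂∈F b

  g-inj : ∀ u v → g u ≡ g v → u ≡ v
  g-inj (inj₁ a) (inj₁ a′) eq = cong inj₁ (f₁-inj eq)
  g-inj (inj₂ b) (inj₂ b′) eq = cong inj₂ (f₂-inj eq)
  g-inj (inj₁ a) (inj₂ b)  eq = ⊥-elim (⊈₁₂ a b (⊆-reflexive eq))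
  g-inj (inj₂ b) (inj₁ a)  eq = ⊥-elim (⊈₂₁ a b (⊆-reflexive eq))

  g-iso : ∀ u v → Pointwise (FinPoset._≼_ P₁) (FinPoset._≼_ P₂) u v ⇔ (g u ⊆ g v)
  g-iso (inj₁ a) (inj₁ a′) = mk⇔⊆ (λ { (inj₁ a≼a′) → Equivalence.to (f₁-iso a a′) a≼a′ })
                                 (λ f⊆ → inj₁ (Equivalence.from (f₁-iso a a′) f⊆))
  g-iso (inj₂ b) (inj₂ b′) = mk⇔⊆ (λ { (inj₂ b≼b′) → Equivalence.to (f₂-iso b b′) b≼b′ })
                                 (λ f⊆ → inj₂ (Equivalence.from (f₂-iso b b′) f⊆))
  g-iso (inj₁ a) (inj₂ b)  = mk⇔⊆ (λ ()) (λ f⊆ → ⊥-elim (⊈₁₂ a b f⊆))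
  g-iso (inj₂ b) (inj₁ a)  = mk⇔⊆ (λ ()) (λ f⊆ → ⊥-elim (⊈₂₁ a b f⊆))

empty-poset-copy : ∀ (Q : FinPoset) n F → FinPoset.size Q ≡ 0 → ContainsCopy Q n F
empty-poset-copy Q n F size≡0 =
  (λ i → ⊥-elim (no-element i)) , (λ i → ⊥-elim (no-element i)) ,
  (λ {i} _ → ⊥-elim (no-element i)) , (λ i _ → ⊥-elim (no-element i))
  where
  no-element : Fin (FinPoset.size Q) → ⊥
  no-element i with subst Fin size≡0 i
  ... | ()

empty-or-free-∅ : (Q : FinPoset) → FinPoset.size Q ≡ 0 ⊎ Free Q 0 (λ _ → false)
empty-or-free-∅ Q = by-size (FinPoset.size Q) refl
  where
  false≢true : false ≢ true
  false≢true ()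

  by-size : ∀ k → FinPoset.size Q ≡ k → FinPoset.size Q ≡ 0 ⊎ Free Q 0 (λ _ → false)
  by-size zero    size≡0 = inj₁ size≡0
  by-size (suc k) size≡k = inj₂ (λ (f , f∈∅ , _) → false≢true (f∈∅ (subst Fin (sym size≡k) zero)))

-- If some family is (P₁ ⊕ P₂)-free, one of P₁, P₂ is nonempty and its bound
-- dominates ℓ(∅) = 0.
bound-nonneg : ∀ P₁ P₂ {b₁ b₂ n F} → LubellBound P₁ b₁ → LubellBound P₂ b₂ →
               Free (P₁ ⊕ P₂) n F → 0ℚ ≤ b₁ ⊔ b₂
bound-nonneg P₁ P₂ {b₁} {b₂} {n} {F} bound₁ bound₂ free
  with empty-or-free-∅ P₁ | empty-or-free-∅ P₂
... | inj₂ free₁ | _          = ℚP.≤-trans (bound₁ 0 (λ _ → false) free₁) (ℚP.p≤p⊔q b₁ b₂)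
... | inj₁ _     | inj₂ free₂ = ℚP.≤-trans (bound₂ 0 (λ _ → false) free₂) (ℚP.p≤q⊔p b₁ b₂)
... | inj₁ size₁ | inj₁ size₂ = ⊥-elim (free (empty-poset-copy (P₁ ⊕ P₂) n F (cong₂ ℕ._+_ size₁ size₂)))

halve : ∀ {x y} → x + x ≤ y + y → x ≤ y
halve {x} {y} x+x≤y+y with x ℚP.≤? y
... | yes x≤y = x≤y
... | no  x≰y = ⊥-elim (ℚP.<-irrefl refl
                  (ℚP.<-≤-trans (ℚP.+-mono-< (ℚP.≰⇒> x≰y) (ℚP.≰⇒> x≰y)) x+x≤y+y))

halve-scaled : ∀ N .{{_ : NonZero N}} {μ c} → fromℕ N * (μ + μ) ≤ fromℕ N * (c + c) → μ ≤ c
halve-scaled N ineq = halve (ℚP.*-cancelˡ-≤-pos (fromℕ N) {{ℚP.normalize-pos N 1}} ineq)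

lubell≤2ⁿ : ∀ n F → lubell n F ≤ ∑ₛ n (λ _ → 1ℚ)
lubell≤2ⁿ n F = subst (_≤ ∑ₛ n (λ _ → 1ℚ)) (sym (lubell-∑ₛ n F))
  (∑ₛ-mono n (λ A → weight≤1 (F A) {A}))
  where
  weight≤1 : ∀ b {A : Subset n} → when b (invBinom n ∣ A ∣) ≤ 1ℚ
  weight≤1 true  {A} = invBinom≤1 n ∣ A ∣
  weight≤1 false     = ℚP.≤ᵇ⇒≤ _

module _ (P₁ P₂ : FinPoset) (b₁ b₂ : ℚ) (bound₁ : LubellBound P₁ b₁) (bound₂ : LubellBound P₂ b₂) where

  private
    P : FinPoset
    P = P₁ ⊕ P₂

  -- For a (P₁ ⊕ P₂)-free F and a planting (x, y): if ℓ(G) > b₁ for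
  -- G = planted F true x y, then G contains P₁, so H = planted F false x y
  -- must be P₂-free (a copy of P₂ would glue to a copy of P₁ ⊕ P₂).  The other
  -- family is bounded by the induction hypothesis L.
  planted-pair-bound : ∀ m L → (∀ G → Free P m G → lubell m G ≤ L) →
    ∀ (F : Family (suc (suc m))) → Free P (suc (suc m)) F → ∀ x y →
    lubell m (planted F true x y) + lubell m (planted F false x y) ≤ (b₁ ⊔ b₂) + L
  planted-pair-bound m L ih F free x y with lubell m (planted F true x y) ℚP.≤? b₁
  ... | yes G≤b₁ = ℚP.+-mono-≤ (ℚP.≤-trans G≤b₁ (ℚP.p≤p⊔q b₁ b₂))
                               (ih (planted F false x y) (restrict-free P (planting false x y) F free))
  ... | no  G≰b₁ =
    subst (_≤ (b₁ ⊔ b₂) + L) (ℚP.+-comm (lubell m (planted F false x y)) (lubell m (planted F true x y)))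
      (ℚP.+-mono-≤ (ℚP.≤-trans (bound₂ m (planted F false x y) H-P₂-free) (ℚP.p≤q⊔p b₁ b₂))
                   (ih (planted F true x y) (restrict-free P (planting true x y) F free)))
    where
    H-P₂-free : Free P₂ m (planted F false x y)
    H-P₂-free c₂ = G≰b₁ (bound₁ m (planted F true x y) (λ c₁ → free (glue-copies P₁ P₂ (suc (suc m)) F
      (push-copy P₁ (planting true x y) F c₁) (push-copy P₂ (planting false x y) F c₂)
      (λ _ _ → plant-incomparable x y _ _) (λ _ _ → plant-incomparable′ x y _ _))))

  -- ℓ(F) ≤ (b₁ ⊔ b₂) + 4 for every (P₁ ⊕ P₂)-free F, by induction on n;
  -- for n ≤ 1 already ℓ(F) ≤ 2ⁿ ≤ 4 suffices.
  lubell-bound : 0ℚ ≤ b₁ ⊔ b₂ → ∀ n F → Free P n F → lubell n F ≤ (b₁ ⊔ b₂) + fromℕ 4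
  lubell-bound M≥0 zero          F _    = ℚP.≤-trans (lubell≤2ⁿ 0 F) (≤-+-nonnegˡ (ℚP.≤ᵇ⇒≤ _) M≥0)
  lubell-bound M≥0 (suc zero)    F _    = ℚP.≤-trans (lubell≤2ⁿ 1 F) (≤-+-nonnegˡ (ℚP.≤ᵇ⇒≤ _) M≥0)
  lubell-bound M≥0 (suc (suc m)) F free = begin
    lubell n F                        ≤⟨ lubell≤2+middle n F ⟩
    fromℕ 2 + middleLubell n F        ≤⟨ ℚP.+-monoʳ-≤ (fromℕ 2) μ≤M+2 ⟩
    fromℕ 2 + (M + fromℕ 2)           ≡⟨ solve 2 (λ M t → t :+ (M :+ t) := M :+ (t :+ t)) refl M (fromℕ 2) ⟩
    M + fromℕ 4                       ∎
    where
    open ℚP.≤-Reasoning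
    open ℚ-Solver
    n : ℕ
    n = suc (suc m)
    M : ℚ
    M = b₁ ⊔ b₂
    μ : ℚ
    μ = middleLubell n F
    pairs : Fin n → Fin (suc m) → ℚ
    pairs x y = lubell m (planted F true x y) + lubell m (planted F false x y)
    -- averaging the pair bound over all n(n−1) plantings
    μ≤M+2 : μ ≤ M + fromℕ 2
    μ≤M+2 = halve-scaled (n ℕ.* suc m) (begin
      fromℕ (n ℕ.* suc m) * (μ + μ)
        ≡⟨ sym (∑-lubell-planted-pairs m F) ⟩
      ∑[ x < n ] ∑[ y < suc m ] pairs x y
        ≤⟨ ∑-mono n (λ x → ∑-mono (suc m) (λ y →
             planted-pair-bound m _ (lubell-bound M≥0 m) F free x y)) ⟩
      ∑[ x < n ] ∑[ y < suc m ] (M + (M + fromℕ 4))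
        ≡⟨ ∑∑-const n (suc m) _ ⟩
      fromℕ (n ℕ.* suc m) * (M + (M + fromℕ 4))
        ≡⟨ cong (fromℕ (n ℕ.* suc m) *_)
             (solve 2 (λ M t → M :+ (M :+ (t :+ t)) := (M :+ t) :+ (M :+ t)) refl M (fromℕ 2)) ⟩
      fromℕ (n ℕ.* suc m) * ((M + fromℕ 2) + (M + fromℕ 2)) ∎)

lemma2p4 : (P₁ P₂ : FinPoset) (b₁ b₂ : ℚ) →
    LubellBound P₁ b₁ → LubellBound P₂ b₂ →
    (n : ℕ) (F : Family n) → Free (P₁ ⊕ P₂) n F →
    lubell n F ≤ (b₁ ⊔ b₂) + (+ 8 / 1)
lemma2p4 P₁ P₂ b₁ b₂ bound₁ bound₂ n F free = begin
  lubell n F            ≤⟨ lubell-bound P₁ P₂ b₁ b₂ bound₁ bound₂ M≥0 n F free ⟩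
  (b₁ ⊔ b₂) + fromℕ 4   ≤⟨ ℚP.+-monoʳ-≤ (b₁ ⊔ b₂) (ℚP.≤ᵇ⇒≤ _) ⟩
  (b₁ ⊔ b₂) + (+ 8 / 1) ∎
  where
  open ℚP.≤-Reasoning
  M≥0 : 0ℚ ≤ b₁ ⊔ b₂
  M≥0 = bound-nonneg P₁ P₂ {n = n} {F} bound₁ bound₂ free
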